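{- Let $p$ be an odd prime, $r\in\mathbb{Z}^+$ and $q=p^r$. For all integers $0\leq l\leq q-2$ and $0\leq i\leq r-1$, $$\left\lfloor\frac{2lp^i}{q-1}\right\rfloor+2\left\lfloor\frac{ -lp^i}{q-1}\right\rfloor-2\left\lfloor\frac{ -2lp^i}{q-1}\right\rfloor-\left\lfloor\frac{4lp^i}{q-1}\right\rfloor=-2\left\lfloor\left\langle \frac{p^i}{2}\right\rangle-\frac{lp^i}{q-1}\right\rfloor-\left\lfloor\left\langle-\frac{p^i}{4}\right\rangle+\frac{lp^i}{q-1}\right\rfloor-\left\lfloor\left\langle-\frac{3p^i}{4}\right\rangle+\frac{lp^i}{q-1}\right\rfloor.$$
   Context: For $x\in\mathbb{Q}$, $\lfloor x\rfloor$ denotes the greatest integer $\leq x$ and $\langle x\rangle=x-\lfloor x\rfloor$ the fractional part. -}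

module Defs where

open import Data.Integer using (ℤ)
open import Data.Rational using (ℚ; floor; _-_; _/_)
import Data.Rational as ℚ

-- fractional part ⟨x⟩ = x - ⌊x⌋ (the paper's convention; note that the
-- library's fracPart differs for negative x, so we do not use it)
frac : ℚ → ℚ
frac x = x - (floor x / 1)

-- Put x = l pⁱ / (q - 1). As pⁱ is odd, ⟨pⁱ/2⟩ = 1/2 and {⟨-pⁱ/4⟩, ⟨-3pⁱ/4⟩} = {1/4, 3/4},
-- so both sides depend on x alone, and the identity holds for every rational x: it is
-- the sum of Hermite's identity ⌊y⌋ + ⌊y + 1/2⌋ = ⌊2y⌋ at y = 2x, y = -x and y = x + 1/4.
module Submission where

open import Defs
open import Data.Nat using (ℕ; _^_; _∸_; _≤_; _<_; NonZero) renaming (_*_ to _*ℕ_)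
open import Data.Nat.Primality using (Prime)
open import Data.Integer using (ℤ; +_; -_) renaming (_+_ to _+ℤ_; _-_ to _-ℤ_; _*_ to _*ℤ_)
open import Data.Rational using (ℚ; floor; _/_) renaming (_+_ to _+ℚ_; _-_ to _-ℚ_)
open import Relation.Binary.PropositionalEquality using (_≡_)

open import Algebra.Properties.CommutativeSemigroup using (xy∙z≈xz∙y)
open import Data.Integer as ℤ using (_+_; _*_; _-_; _/ℕ_; _%ℕ_; 1ℤ)
import Data.Integer.Properties as ℤP
open import Data.Integer.DivMod using (a≡a%ℕn+[a/ℕn]*n; [n/ℕd]*d≤n; n<s[n/ℕd]*d; n%ℕd<d)
open import Data.Integer.GCD using (gcd)
open import Data.Integer.Solver using (module +-*-Solver)
import Data.Nat as ℕ
import Data.Nat.DivMod as ℕD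
open import Data.Nat.Divisibility using (_∤_; divides; ∣1⇒≡1; m%n≡0⇒n∣m)
open import Data.Nat.Primality using (prime[2]; ¬prime[1]; euclidsLemma; prime⇒irreducible)
import Data.Nat.Properties as ℕP
import Data.Nat.Solver as ℕSolver
open import Data.Product using (_×_; _,_)
open import Data.Rational as ℚ using (mkℚ; ↥_; ↧_; ↧ₙ_; ½)
import Data.Rational.Properties as ℚP
import Data.Rational.Solver as ℚSolver
import Data.Rational.Unnormalised as ℚᵘ
import Data.Rational.Unnormalised.Properties as ℚᵘP
open import Data.Sum as Sum using (_⊎_; inj₁; inj₂)
open import Relation.Binary.PropositionalEquality using (refl; sym; trans; cong; cong₂; subst; subst₂; module ≡-Reasoning)
open import Relation.Nullary using (¬_; contradiction)

private
  +-positive : ∀ n .{{_ : NonZero n}} → ℤ.Positive (+ n)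
  +-positive n = ℤ.positive (ℤ.+<+ (ℕ.>-nonZero⁻¹ n))

  n+n≡n*2 : ∀ n → n ℕ.+ n ≡ n *ℕ 2
  n+n≡n*2 n = trans (cong (n ℕ.+_) (sym (ℕP.*-identityʳ n))) (sym (ℕP.*-suc n 1))

/ℕ-unique : ∀ {z} k n .{{_ : NonZero n}} → k * + n ℤ.≤ z → z ℤ.< ℤ.suc k * + n → z /ℕ n ≡ k
/ℕ-unique {z} k n k*n≤z z<[1+k]*n = ℤP.≤-antisym (ℤP.≮⇒≥ k≮q) (ℤP.≮⇒≥ q≮k)
  where
  q = z /ℕ n
  scale : ∀ {a b} → a ℤ.< b → ℤ.suc a * + n ℤ.≤ b * + n
  scale a<b = ℤP.*-monoʳ-≤-nonNeg (+ n) (ℤP.i<j⇒suc[i]≤j a<b)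
  k≮q : ¬ k ℤ.< q
  k≮q k<q = ℤP.<-irrefl refl (ℤP.≤-<-trans (ℤP.≤-trans (scale k<q) ([n/ℕd]*d≤n z n)) z<[1+k]*n)
  q≮k : ¬ q ℤ.< k
  q≮k q<k = ℤP.<-irrefl refl (ℤP.≤-<-trans (ℤP.≤-trans (scale q<k) k*n≤z) (n<s[n/ℕd]*d z n))

z≡k*n+r⇒z/ℕn≡k : ∀ {z} k n .{{_ : NonZero n}} r → z ≡ k * + n + + r → r < n → z /ℕ n ≡ k
z≡k*n+r⇒z/ℕn≡k k n r refl r<n = /ℕ-unique k n (ℤP.i≤i+j (k * + n) (+ r)) (begin-strict
    k * + n + + r    <⟨ ℤP.+-monoʳ-< (k * + n) (ℤ.+<+ r<n) ⟩
    k * + n + + n    ≡⟨ ℤP.+-comm (k * + n) (+ n) ⟩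
    + n + k * + n    ≡⟨ ℤP.suc-* k (+ n) ⟨
    ℤ.suc k * + n    ∎)
  where open ℤP.≤-Reasoning

/ℕ-cross : ∀ i j m n .{{_ : NonZero m}} .{{_ : NonZero n}} →
           i * + n ≡ j * + m → i /ℕ m ≡ j /ℕ n
/ℕ-cross i j m n i*n≡j*m = sym (/ℕ-unique q n lower upper)
  where
  open +-*-Solver
  q = i /ℕ m
  swap : ∀ a → a * + m * + n ≡ a * + n * + m
  swap a = solve 3 (λ a m n → a :* m :* n := a :* n :* m) refl a (+ m) (+ n)
  lower : q * + n ℤ.≤ j
  lower = ℤP.*-cancelʳ-≤-pos (q * + n) j (+ m) {{+-positive m}}
    (subst₂ ℤ._≤_ (swap q) i*n≡j*m (ℤP.*-monoʳ-≤-nonNeg (+ n) ([n/ℕd]*d≤n i m)))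
  upper : j ℤ.< ℤ.suc q * + n
  upper = ℤP.*-cancelʳ-<-nonNeg (+ m)
    (subst₂ ℤ._<_ i*n≡j*m (swap (ℤ.suc q)) (ℤP.*-monoʳ-<-pos (+ n) {{+-positive n}} (n<s[n/ℕd]*d i m)))

module _ (z : ℤ) (n : ℕ) .{{_ : NonZero n}} where
  open ≡-Reasoning
  open +-*-Solver

  private
    instance
      n*2-nonZero : NonZero (n *ℕ 2)
      n*2-nonZero = ℕP.m*n≢0 n 2

    q = z /ℕ n
    r = z %ℕ n

    z≡q*n+r : z ≡ q * + n + + r
    z≡q*n+r = trans (a≡a%ℕn+[a/ℕn]*n z n) (ℤP.+-comm (+ r) (q * + n))

    hermite-small-remainder : r *ℕ 2 < n → q + (z * + 2 + + n) /ℕ (n *ℕ 2) ≡ (z * + 2) /ℕ n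
    hermite-small-remainder 2r<n = begin
        q + (z * + 2 + + n) /ℕ (n *ℕ 2)  ≡⟨ cong (λ w → q + w) (z≡k*n+r⇒z/ℕn≡k q (n *ℕ 2) (r *ℕ 2 ℕ.+ n) shifted upper) ⟩
        q + q                            ≡⟨ solve 1 (λ q → q :+ q := q :* con (+ 2)) refl q ⟩
        q * + 2                          ≡⟨ z≡k*n+r⇒z/ℕn≡k (q * + 2) n (r *ℕ 2) doubled 2r<n ⟨
        (z * + 2) /ℕ n                   ∎
      where
      upper : r *ℕ 2 ℕ.+ n < n *ℕ 2
      upper = subst (r *ℕ 2 ℕ.+ n <_) (n+n≡n*2 n) (ℕP.+-monoˡ-< n 2r<n)
      shifted : z * + 2 + + n ≡ q * + (n *ℕ 2) + + (r *ℕ 2 ℕ.+ n)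
      shifted = begin
        z * + 2 + + n                        ≡⟨ cong (λ w → w * + 2 + + n) z≡q*n+r ⟩
        (q * + n + + r) * + 2 + + n          ≡⟨ solve 3 (λ q n r → (q :* n :+ r) :* con (+ 2) :+ n := q :* (n :* con (+ 2)) :+ (r :* con (+ 2) :+ n)) refl q (+ n) (+ r) ⟩
        q * (+ n * + 2) + (+ r * + 2 + + n)  ≡⟨ cong₂ (λ a b → q * a + (b + + n)) (ℤP.pos-* n 2) (ℤP.pos-* r 2) ⟨
        q * + (n *ℕ 2) + (+ (r *ℕ 2) + + n)  ≡⟨ cong (λ w → q * + (n *ℕ 2) + w) (ℤP.pos-+ (r *ℕ 2) n) ⟨
        q * + (n *ℕ 2) + + (r *ℕ 2 ℕ.+ n)    ∎
      doubled : z * + 2 ≡ q * + 2 * + n + + (r *ℕ 2)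
      doubled = begin
        z * + 2                      ≡⟨ cong (_* + 2) z≡q*n+r ⟩
        (q * + n + + r) * + 2        ≡⟨ solve 3 (λ q n r → (q :* n :+ r) :* con (+ 2) := q :* con (+ 2) :* n :+ r :* con (+ 2)) refl q (+ n) (+ r) ⟩
        q * + 2 * + n + + r * + 2    ≡⟨ cong (λ w → q * + 2 * + n + w) (ℤP.pos-* r 2) ⟨
        q * + 2 * + n + + (r *ℕ 2)   ∎

    hermite-large-remainder : n ≤ r *ℕ 2 → q + (z * + 2 + + n) /ℕ (n *ℕ 2) ≡ (z * + 2) /ℕ n
    hermite-large-remainder n≤2r = begin
        q + (z * + 2 + + n) /ℕ (n *ℕ 2)  ≡⟨ cong (λ w → q + w) (z≡k*n+r⇒z/ℕn≡k (ℤ.suc q) (n *ℕ 2) e shifted (ℕP.<-≤-trans e<n (ℕP.m≤m*n n 2))) ⟩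
        q + ℤ.suc q                      ≡⟨ solve 1 (λ q → q :+ (con 1ℤ :+ q) := q :* con (+ 2) :+ con 1ℤ) refl q ⟩
        q * + 2 + 1ℤ                     ≡⟨ z≡k*n+r⇒z/ℕn≡k (q * + 2 + 1ℤ) n e doubled e<n ⟨
        (z * + 2) /ℕ n                   ∎
      where
      e = r *ℕ 2 ∸ n
      e+n≡2r : + e + + n ≡ + r * + 2
      e+n≡2r = trans (sym (ℤP.pos-+ e n)) (trans (cong +_ (ℕP.m∸n+n≡m n≤2r)) (ℤP.pos-* r 2))
      e<n : e < n
      e<n = ℕP.+-cancelʳ-< n e n
        (subst₂ _<_ (sym (ℕP.m∸n+n≡m n≤2r)) (sym (n+n≡n*2 n)) (ℕP.*-monoˡ-< 2 (n%ℕd<d z n)))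
      shifted : z * + 2 + + n ≡ ℤ.suc q * + (n *ℕ 2) + + e
      shifted = begin
        z * + 2 + + n                        ≡⟨ cong (λ w → w * + 2 + + n) z≡q*n+r ⟩
        (q * + n + + r) * + 2 + + n          ≡⟨ solve 3 (λ q n r → (q :* n :+ r) :* con (+ 2) :+ n := q :* (n :* con (+ 2)) :+ n :+ r :* con (+ 2)) refl q (+ n) (+ r) ⟩
        q * (+ n * + 2) + + n + + r * + 2    ≡⟨ cong (λ w → q * (+ n * + 2) + + n + w) e+n≡2r ⟨
        q * (+ n * + 2) + + n + (+ e + + n)  ≡⟨ solve 3 (λ q n e → q :* (n :* con (+ 2)) :+ n :+ (e :+ n) := (con 1ℤ :+ q) :* (n :* con (+ 2)) :+ e) refl q (+ n) (+ e) ⟩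
        ℤ.suc q * (+ n * + 2) + + e          ≡⟨ cong (λ w → ℤ.suc q * w + + e) (ℤP.pos-* n 2) ⟨
        ℤ.suc q * + (n *ℕ 2) + + e           ∎
      doubled : z * + 2 ≡ (q * + 2 + 1ℤ) * + n + + e
      doubled = begin
        z * + 2                      ≡⟨ cong (_* + 2) z≡q*n+r ⟩
        (q * + n + + r) * + 2        ≡⟨ solve 3 (λ q n r → (q :* n :+ r) :* con (+ 2) := q :* con (+ 2) :* n :+ r :* con (+ 2)) refl q (+ n) (+ r) ⟩
        q * + 2 * + n + + r * + 2    ≡⟨ cong (λ w → q * + 2 * + n + w) e+n≡2r ⟨
        q * + 2 * + n + (+ e + + n)  ≡⟨ solve 3 (λ q n e → q :* con (+ 2) :* n :+ (e :+ n) := (q :* con (+ 2) :+ con 1ℤ) :* n :+ e) refl q (+ n) (+ e) ⟩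
        (q * + 2 + 1ℤ) * + n + + e   ∎

  /ℕ-hermite : z /ℕ n + (z * + 2 + + n) /ℕ (n *ℕ 2) ≡ (z * + 2) /ℕ n
  /ℕ-hermite = Sum.[ hermite-small-remainder , hermite-large-remainder ]′ (ℕP.<-≤-connex (r *ℕ 2) n)

/-cross : ∀ i j m n .{{_ : NonZero m}} .{{_ : NonZero n}} → i * + n ≡ j * + m → i / m ≡ j / n
/-cross i j (ℕ.suc m) (ℕ.suc n) i*n≡j*m = ℚP.fromℚᵘ-cong {ℚᵘ.mkℚᵘ i m} {ℚᵘ.mkℚᵘ j n} (ℚᵘ.*≡* i*n≡j*m)

/-distrib-+ : ∀ i j n .{{_ : NonZero n}} → (i + j) / n ≡ i / n +ℚ j / n
/-distrib-+ i j n@(ℕ.suc _) = ℚP.toℚᵘ-injective (begin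
    ℚ.toℚᵘ ((i + j) / n)                ≈⟨ ℚP.toℚᵘ-fromℚᵘ _ ⟩
    (i + j) ℚᵘ./ n                      ≈⟨ ℚᵘ.*≡* cross ⟩
    i ℚᵘ./ n ℚᵘ.+ j ℚᵘ./ n              ≈⟨ ℚᵘP.+-cong (ℚP.toℚᵘ-fromℚᵘ (i ℚᵘ./ n)) (ℚP.toℚᵘ-fromℚᵘ (j ℚᵘ./ n)) ⟨
    ℚ.toℚᵘ (i / n) ℚᵘ.+ ℚ.toℚᵘ (j / n)  ≈⟨ ℚP.toℚᵘ-homo-+ (i / n) (j / n) ⟨
    ℚ.toℚᵘ (i / n +ℚ j / n)             ∎)
  where
  open ℚᵘP.≃-Reasoning
  open +-*-Solver
  cross : (i + j) * + (n *ℕ n) ≡ (i * + n + j * + n) * + n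
  cross = trans (cong ((i + j) *_) (ℤP.pos-* n n))
            (solve 3 (λ i j n → (i :+ j) :* (n :* n) := (i :* n :+ j :* n) :* n) refl i j (+ n))

/-neg : ∀ i n .{{_ : NonZero n}} → (- i) / n ≡ ℚ.- (i / n)
/-neg i n@(ℕ.suc _) = ℚP.toℚᵘ-injective (begin
    ℚ.toℚᵘ ((- i) / n)        ≈⟨ ℚP.toℚᵘ-fromℚᵘ _ ⟩
    ℚᵘ.- (i ℚᵘ./ n)           ≈⟨ ℚᵘP.-‿cong (ℚP.toℚᵘ-fromℚᵘ (i ℚᵘ./ n)) ⟨
    ℚᵘ.- ℚ.toℚᵘ (i / n)       ≈⟨ ℚP.toℚᵘ-homo‿- (i / n) ⟨
    ℚ.toℚᵘ (ℚ.- (i / n))      ∎)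
  where open ℚᵘP.≃-Reasoning

floor-/ : ∀ i n .{{_ : NonZero n}} → floor (i / n) ≡ i /ℕ n
floor-/ i n = trans (floor≡↥/ℕ↧ p) (/ℕ-cross (↥ p) i (↧ₙ p) n (begin
    ↥ p * + n          ≡⟨ cong (↥ p *_) (ℚP.↧-/ i n) ⟨
    ↥ p * (↧ p * g)    ≡⟨ solve 3 (λ a b g → a :* (b :* g) := a :* g :* b) refl (↥ p) (↧ p) g ⟩
    ↥ p * g * ↧ p      ≡⟨ cong (_* ↧ p) (ℚP.↥-/ i n) ⟩
    i * ↧ p            ∎))
  where
  open ≡-Reasoning
  open +-*-Solver
  p = i / n
  g = gcd i (+ n)
  floor≡↥/ℕ↧ : ∀ y → floor y ≡ ↥ y /ℕ ↧ₙ y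
  floor≡↥/ℕ↧ (mkℚ a d _) = ℤP.*-identityˡ (a /ℕ ℕ.suc d)

floor-hermite : ∀ y → floor y + floor (y +ℚ ½) ≡ floor (y +ℚ y)
floor-hermite y@(mkℚ a d _) = begin
    floor y + floor (y +ℚ ½)                      ≡⟨ cong₂ _+_ (ℤP.*-identityˡ (a /ℕ n)) (floor-/ (a * + 2 + 1ℤ * + n) (n *ℕ 2)) ⟩
    a /ℕ n + (a * + 2 + 1ℤ * + n) /ℕ (n *ℕ 2)     ≡⟨ cong (λ w → a /ℕ n + (a * + 2 + w) /ℕ (n *ℕ 2)) (ℤP.*-identityˡ (+ n)) ⟩
    a /ℕ n + (a * + 2 + + n) /ℕ (n *ℕ 2)          ≡⟨ /ℕ-hermite a n ⟩
    (a * + 2) /ℕ n                                ≡⟨ /ℕ-cross (a * + 2) (a * + n + a * + n) n (n *ℕ n) doubled ⟩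
    (a * + n + a * + n) /ℕ (n *ℕ n)               ≡⟨ floor-/ (a * + n + a * + n) (n *ℕ n) ⟨
    floor (y +ℚ y)                                ∎
  where
  open ≡-Reasoning
  open +-*-Solver
  n = ℕ.suc d
  doubled : a * + 2 * + (n *ℕ n) ≡ (a * + n + a * + n) * + n
  doubled = trans (cong (a * + 2 *_) (ℤP.pos-* n n))
              (solve 2 (λ a n → a :* con (+ 2) :* (n :* n) := (a :* n :+ a :* n) :* n) refl a (+ n))

frac-/ : ∀ z k n .{{_ : NonZero n}} r → z ≡ k * + n + + r → r < n → frac (z / n) ≡ + r / n
frac-/ z k n r z≡k*n+r r<n = begin
    z / n -ℚ floor (z / n) / 1            ≡⟨ cong (λ w → z / n -ℚ w / 1) (trans (floor-/ z n) (z≡k*n+r⇒z/ℕn≡k k n r z≡k*n+r r<n)) ⟩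
    z / n -ℚ k / 1                        ≡⟨ cong (λ w → w / n -ℚ k / 1) z≡k*n+r ⟩
    (k * + n + + r) / n -ℚ k / 1          ≡⟨ cong (_-ℚ k / 1) (/-distrib-+ (k * + n) (+ r) n) ⟩
    (k * + n) / n +ℚ + r / n -ℚ k / 1     ≡⟨ cong (λ w → w +ℚ + r / n -ℚ k / 1) (/-cross (k * + n) k n 1 (ℤP.*-identityʳ (k * + n))) ⟩
    k / 1 +ℚ + r / n -ℚ k / 1             ≡⟨ solve 2 (λ a b → a :+ b :- a := b) refl (k / 1) (+ r / n) ⟩
    + r / n                               ∎
  where
  open ≡-Reasoning
  open ℚSolver.+-*-Solver

¼ ¾ : ℚ
¼ = + 1 / 4
¾ = + 3 / 4

private
  hermite-combination : ∀ t₁ t₂ r b c {t₃ t₄ s} → t₁ + s ≡ t₄ → t₂ + r ≡ t₃ → b + c ≡ s →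
                        t₁ + + 2 * t₂ - + 2 * t₃ - t₄ ≡ - (+ 2 * r) - c - b
  hermite-combination t₁ t₂ r b c refl refl refl =
    solve 5 (λ t₁ t₂ r b c → t₁ :+ con (+ 2) :* t₂ :- con (+ 2) :* (t₂ :+ r) :- (t₁ :+ (b :+ c))
                           := :- (con (+ 2) :* r) :- c :- b) refl t₁ t₂ r b c
    where open +-*-Solver

floor-identity : ∀ x →
  floor (x +ℚ x) + + 2 * floor (ℚ.- x) - + 2 * floor (ℚ.- x +ℚ ℚ.- x) - floor ((x +ℚ x) +ℚ (x +ℚ x))
  ≡ - (+ 2 * floor (½ -ℚ x)) - floor (¾ +ℚ x) - floor (¼ +ℚ x)
floor-identity x =
  hermite-combination (floor (x +ℚ x)) (floor (ℚ.- x)) (floor (½ -ℚ x)) (floor (¼ +ℚ x)) (floor (¾ +ℚ x))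
    (floor-hermite (x +ℚ x)) at-minus-x at-x+¼
  where
  open ℚSolver.+-*-Solver
  at-minus-x : floor (ℚ.- x) + floor (½ -ℚ x) ≡ floor (ℚ.- x +ℚ ℚ.- x)
  at-minus-x = subst (λ w → floor (ℚ.- x) + floor w ≡ floor (ℚ.- x +ℚ ℚ.- x))
                 (ℚP.+-comm (ℚ.- x) ½) (floor-hermite (ℚ.- x))
  at-x+¼ : floor (¼ +ℚ x) + floor (¾ +ℚ x) ≡ floor (x +ℚ x +ℚ ½)
  at-x+¼ = subst₂ (λ u v → floor (¼ +ℚ x) + floor u ≡ floor v)
             (solve 1 (λ x → con ¼ :+ x :+ con ½ := con ¾ :+ x) refl x)
             (solve 1 (λ x → (con ¼ :+ x) :+ (con ¼ :+ x) := x :+ x :+ con ½) refl x)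
             (floor-hermite (¼ +ℚ x))

module _ (a : ℤ) (n : ℕ) .{{_ : NonZero n}} where
  open +-*-Solver

  private
    x = a / n
    [2a]/n≡x+x : (+ 2 * a) / n ≡ x +ℚ x
    [2a]/n≡x+x = trans (cong (_/ n) (solve 1 (λ a → con (+ 2) :* a := a :+ a) refl a)) (/-distrib-+ a a n)
    [4a]/n≡4x : (+ 4 * a) / n ≡ (x +ℚ x) +ℚ (x +ℚ x)
    [4a]/n≡4x = trans (cong (_/ n) (solve 1 (λ a → con (+ 4) :* a := con (+ 2) :* a :+ con (+ 2) :* a) refl a))
                  (trans (/-distrib-+ (+ 2 * a) (+ 2 * a) n) (cong₂ _+ℚ_ [2a]/n≡x+x [2a]/n≡x+x))
    [-2a]/n≡-x-x : (- (+ 2 * a)) / n ≡ ℚ.- x +ℚ ℚ.- x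
    [-2a]/n≡-x-x = trans (/-neg (+ 2 * a) n) (trans (cong ℚ.-_ [2a]/n≡x+x) (ℚP.neg-distrib-+ x x))

  floor-identity-/ :
    floor ((+ 2 * a) / n) + + 2 * floor ((- a) / n) - + 2 * floor ((- (+ 2 * a)) / n) - floor ((+ 4 * a) / n)
    ≡ - (+ 2 * floor (½ -ℚ x)) - floor (¾ +ℚ x) - floor (¼ +ℚ x)
  floor-identity-/ = begin
      floor ((+ 2 * a) / n) + + 2 * floor ((- a) / n) - + 2 * floor ((- (+ 2 * a)) / n) - floor ((+ 4 * a) / n)
        ≡⟨ cong₂ (λ u v → floor u + + 2 * floor ((- a) / n) - + 2 * floor v - floor ((+ 4 * a) / n)) [2a]/n≡x+x [-2a]/n≡-x-x ⟩
      floor (x +ℚ x) + + 2 * floor ((- a) / n) - + 2 * floor (ℚ.- x +ℚ ℚ.- x) - floor ((+ 4 * a) / n)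
        ≡⟨ cong₂ (λ u v → floor (x +ℚ x) + + 2 * floor u - + 2 * floor (ℚ.- x +ℚ ℚ.- x) - floor v) (/-neg a n) [4a]/n≡4x ⟩
      floor (x +ℚ x) + + 2 * floor (ℚ.- x) - + 2 * floor (ℚ.- x +ℚ ℚ.- x) - floor ((x +ℚ x) +ℚ (x +ℚ x))
        ≡⟨ floor-identity x ⟩
      - (+ 2 * floor (½ -ℚ x)) - floor (¾ +ℚ x) - floor (¼ +ℚ x) ∎
    where open ≡-Reasoning

prime>2⇒2∤ : ∀ {p} → Prime p → 2 < p → 2 ∤ p
prime>2⇒2∤ p-prime 2<p 2∣p with prime⇒irreducible p-prime 2∣p
... | inj₁ ()
... | inj₂ refl = ℕP.<-irrefl refl 2<p

prime∤⇒∤^ : ∀ {q m} → Prime q → q ∤ m → ∀ i → q ∤ m ^ i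
prime∤⇒∤^ q-prime q∤m ℕ.zero q∣1 = ¬prime[1] (subst Prime (∣1⇒≡1 q∣1) q-prime)
prime∤⇒∤^ {m = m} q-prime q∤m (ℕ.suc i) q∣m^[1+i] =
  Sum.[ q∤m , prime∤⇒∤^ q-prime q∤m i ] (euclidsLemma m (m ^ i) q-prime q∣m^[1+i])

n%d≡r⇒+n≡[n/d]*d+r : ∀ n d .{{_ : NonZero d}} {r} → n ℕ.% d ≡ r → + n ≡ + (n ℕ./ d) * + d + + r
n%d≡r⇒+n≡[n/d]*d+r n d refl = begin
    + n                                 ≡⟨ cong +_ (trans (ℕD.m≡m%n+[m/n]*n n d) (ℕP.+-comm (n ℕ.% d) _)) ⟩
    + (n ℕ./ d *ℕ d ℕ.+ n ℕ.% d)        ≡⟨ ℤP.pos-+ (n ℕ./ d *ℕ d) (n ℕ.% d) ⟩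
    + (n ℕ./ d *ℕ d) + + (n ℕ.% d)      ≡⟨ cong (_+ + (n ℕ.% d)) (ℤP.pos-* (n ℕ./ d) d) ⟩
    + (n ℕ./ d) * + d + + (n ℕ.% d)     ∎
  where open ≡-Reasoning

2∤⇒%4≡1⊎%4≡3 : ∀ n → 2 ∤ n → n ℕ.% 4 ≡ 1 ⊎ n ℕ.% 4 ≡ 3
2∤⇒%4≡1⊎%4≡3 n 2∤n with n ℕ.% 4 | ℕD.m%n<n n 4 | ℕD.m≡m%n+[m/n]*n n 4
... | 0 | _ | n≡ = contradiction (divides (n ℕ./ 4 *ℕ 2) (trans n≡
    (solve 1 (λ q → con 0 :+ q :* con 4 := q :* con 2 :* con 2) refl (n ℕ./ 4)))) 2∤n
  where open ℕSolver.+-*-Solver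
... | 1 | _ | _ = inj₁ refl
... | 2 | _ | n≡ = contradiction (divides (1 ℕ.+ n ℕ./ 4 *ℕ 2) (trans n≡
    (solve 1 (λ q → con 2 :+ q :* con 4 := (con 1 :+ q :* con 2) :* con 2) refl (n ℕ./ 4)))) 2∤n
  where open ℕSolver.+-*-Solver
... | 3 | _ | _ = inj₂ refl
... | ℕ.suc (ℕ.suc (ℕ.suc (ℕ.suc _))) | ℕ.s≤s (ℕ.s≤s (ℕ.s≤s (ℕ.s≤s ()))) | _

2∤⇒frac[n/2]≡½ : ∀ n → 2 ∤ n → frac (+ n / 2) ≡ ½
2∤⇒frac[n/2]≡½ n 2∤n with n ℕ.% 2 in n%2≡ | ℕD.m%n<n n 2
... | 0 | _ = contradiction (m%n≡0⇒n∣m n 2 n%2≡) 2∤n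
... | 1 | _ = frac-/ (+ n) (+ (n ℕ./ 2)) 2 1 (n%d≡r⇒+n≡[n/d]*d+r n 2 n%2≡) (ℕP.n<1+n 1)
... | ℕ.suc (ℕ.suc _) | ℕ.s≤s (ℕ.s≤s ())

2∤⇒frac-quarters : ∀ n → 2 ∤ n →
  frac ((- + n) / 4) ≡ ¾ × frac ((- (+ 3 * + n)) / 4) ≡ ¼ ⊎
  frac ((- + n) / 4) ≡ ¼ × frac ((- (+ 3 * + n)) / 4) ≡ ¾
2∤⇒frac-quarters n 2∤n with 2∤⇒%4≡1⊎%4≡3 n 2∤n
... | inj₁ n%4≡1 = inj₁ ( frac-/ (- + n) (- q - 1ℤ) 4 3 -n≡ (ℕP.n<1+n 3)
                       , frac-/ (- (+ 3 * + n)) (- (+ 3 * q) - 1ℤ) 4 1 -3n≡ (ℕ.s≤s (ℕ.s≤s ℕ.z≤n)))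
  where
  open +-*-Solver
  q = + (n ℕ./ 4)
  n≡ : + n ≡ q * + 4 + + 1
  n≡ = n%d≡r⇒+n≡[n/d]*d+r n 4 n%4≡1
  -n≡ : - + n ≡ (- q - 1ℤ) * + 4 + + 3
  -n≡ = trans (cong -_ n≡)
    (solve 1 (λ q → :- (q :* con (+ 4) :+ con (+ 1)) := (:- q :- con 1ℤ) :* con (+ 4) :+ con (+ 3)) refl q)
  -3n≡ : - (+ 3 * + n) ≡ (- (+ 3 * q) - 1ℤ) * + 4 + + 1
  -3n≡ = trans (cong (λ w → - (+ 3 * w)) n≡)
    (solve 1 (λ q → :- (con (+ 3) :* (q :* con (+ 4) :+ con (+ 1)))
                  := (:- (con (+ 3) :* q) :- con 1ℤ) :* con (+ 4) :+ con (+ 1)) refl q)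
... | inj₂ n%4≡3 = inj₂ ( frac-/ (- + n) (- q - 1ℤ) 4 1 -n≡ (ℕ.s≤s (ℕ.s≤s ℕ.z≤n))
                       , frac-/ (- (+ 3 * + n)) (- (+ 3 * q) - + 3) 4 3 -3n≡ (ℕP.n<1+n 3))
  where
  open +-*-Solver
  q = + (n ℕ./ 4)
  n≡ : + n ≡ q * + 4 + + 3
  n≡ = n%d≡r⇒+n≡[n/d]*d+r n 4 n%4≡3
  -n≡ : - + n ≡ (- q - 1ℤ) * + 4 + + 1
  -n≡ = trans (cong -_ n≡)
    (solve 1 (λ q → :- (q :* con (+ 4) :+ con (+ 3)) := (:- q :- con 1ℤ) :* con (+ 4) :+ con (+ 1)) refl q)
  -3n≡ : - (+ 3 * + n) ≡ (- (+ 3 * q) - + 3) * + 4 + + 3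
  -3n≡ = trans (cong (λ w → - (+ 3 * w)) n≡)
    (solve 1 (λ q → :- (con (+ 3) :* (q :* con (+ 4) :+ con (+ 3)))
                  := (:- (con (+ 3) :* q) :- con (+ 3)) :* con (+ 4) :+ con (+ 3)) refl q)

lemma3p3 : (p r : ℕ) → Prime p → 3 ≤ p → 1 ≤ r →
           .{{_ : NonZero (p ^ r ∸ 1)}} →
           (l i : ℕ) → l ≤ p ^ r ∸ 2 → i < r →
           floor (((+ 2) *ℤ (+ (l *ℕ p ^ i))) / (p ^ r ∸ 1))
           +ℤ (+ 2) *ℤ floor ((- (+ (l *ℕ p ^ i))) / (p ^ r ∸ 1))
           -ℤ (+ 2) *ℤ floor ((- ((+ 2) *ℤ (+ (l *ℕ p ^ i)))) / (p ^ r ∸ 1))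
           -ℤ floor (((+ 4) *ℤ (+ (l *ℕ p ^ i))) / (p ^ r ∸ 1))
           ≡
           - ((+ 2) *ℤ floor (frac ((+ (p ^ i)) / 2) -ℚ ((+ (l *ℕ p ^ i)) / (p ^ r ∸ 1))))
           -ℤ floor (frac ((- (+ (p ^ i))) / 4) +ℚ ((+ (l *ℕ p ^ i)) / (p ^ r ∸ 1)))
           -ℤ floor (frac ((- ((+ 3) *ℤ (+ (p ^ i)))) / 4) +ℚ ((+ (l *ℕ p ^ i)) / (p ^ r ∸ 1)))
lemma3p3 p r p-prime 2<p _ l i _ _
  with 2∤⇒frac[n/2]≡½ (p ^ i) 2∤p^i | 2∤⇒frac-quarters (p ^ i) 2∤p^i
  where 2∤p^i = prime∤⇒∤^ prime[2] (prime>2⇒2∤ p-prime 2<p) i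
... | half | inj₁ (frac-n/4 , frac-3n/4) rewrite half | frac-n/4 | frac-3n/4 =
  floor-identity-/ (+ (l *ℕ p ^ i)) (p ^ r ∸ 1)
... | half | inj₂ (frac-n/4 , frac-3n/4) rewrite half | frac-n/4 | frac-3n/4 =
  trans (floor-identity-/ (+ (l *ℕ p ^ i)) (p ^ r ∸ 1))
        (xy∙z≈xz∙y ℤP.+-commutativeSemigroup (- (+ 2 * floor (½ -ℚ x))) (- floor (¾ +ℚ x)) (- floor (¼ +ℚ x)))
  where x = + (l *ℕ p ^ i) / (p ^ r ∸ 1)
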